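{- For every nonnegative integer $n$, $$\binom{2n}n\sum_{k=0}^n\binom{2k}k^2\binom{2(n-k)}{n-k}4^{n-k}=\sum_{k=0}^n\binom{4k}{2k}\binom{2k}k^2\binom k{n-k}(-64)^{n-k}.$$
   Context: $\binom{k}{j}=0$ when $j>k$. -}

module Defs where

open import Data.Nat using (ℕ; zero; suc)
open import Data.Integer using (ℤ; _+_)

sumTo : ℕ → (ℕ → ℤ) → ℤ
sumTo zero    f = f 0
sumTo (suc n) f = sumTo n f + f (suc n)

-- Both sides satisfy the recurrence τ₀ n u n + τ₁ n u (n + 1) + τ₂ n u (n + 2) = 0, whose leading
-- coefficient τ₂ n = (n + 1) (n + 2)³ never vanishes, and they agree at n = 0 and n = 1.
-- Creative telescoping (Zeilberger) gives the inner sum on the left a recurrence σ, with certificate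
-- k² binomial (2k) k² ω (n + 2 - k) where ω j = 4 ^ j binomial (2j) j / (2j - 1); multiplying by the
-- hypergeometric factor binomial (2n) n turns σ into τ. The right side satisfies τ directly, with
-- certificate -(n + 1) (n + 2) k² F (n + 2) k for its summand F. After clearing denominators, each
-- certificate identity is a polynomial combination of the first-order recurrences of the
-- hypergeometric factors.
module Submission where

open import Defs
open import Data.Nat using (ℕ; zero; suc; _∸_; _≤_; _<_; z≤n; s≤s)
import Data.Nat as ℕ
import Data.Nat.Properties as ℕₚ
open import Data.Nat.Combinatorics using (_C_; nCk+nC[k+1]≡[n+1]C[k+1]; nCk≡nC[n∸k]; nC1≡n)
open import Data.Integer using (ℤ; +_; -_; _+_; _-_; _*_; _^_; 0ℤ; NonZero; ≢-nonZero)
open import Data.Integer.Properties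
  using (pos-+; pos-*; i*j≢0; *-comm; *-assoc; +-comm; +-identityʳ; +-inverseʳ; *-zeroʳ; *-distribˡ-+; *-cancelˡ-≡; i-j≡0⇒i≡j;
         +-commutativeSemigroup; *-commutativeSemigroup)
open import Algebra.Properties.CommutativeSemigroup +-commutativeSemigroup
  using (interchange)
open import Algebra.Properties.CommutativeSemigroup *-commutativeSemigroup
  using (x∙yz≈y∙xz)
open import Data.Integer.Tactic.RingSolver using (solve-∀)
open import Data.Sum using (inj₁; inj₂)
open import Data.Product using (_×_; _,_; proj₁)
open import Relation.Binary.PropositionalEquality
  using (_≡_; _≢_; refl; sym; trans; cong; cong₂; subst; module ≡-Reasoning)
open ≡-Reasoning

sumTo-cong : ∀ m {f g : ℕ → ℤ} → (∀ {k} → k ≤ m → f k ≡ g k) → sumTo m f ≡ sumTo m g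
sumTo-cong zero    f≗g = f≗g z≤n
sumTo-cong (suc m) f≗g = cong₂ _+_ (sumTo-cong m (λ k≤m → f≗g (ℕₚ.m≤n⇒m≤1+n k≤m))) (f≗g ℕₚ.≤-refl)

sumTo-+ : ∀ m (f g : ℕ → ℤ) → sumTo m (λ k → f k + g k) ≡ sumTo m f + sumTo m g
sumTo-+ zero    f g = refl
sumTo-+ (suc m) f g = begin
  sumTo m (λ k → f k + g k) + (f (suc m) + g (suc m))
    ≡⟨ cong (_+ (f (suc m) + g (suc m))) (sumTo-+ m f g) ⟩
  sumTo m f + sumTo m g + (f (suc m) + g (suc m))
    ≡⟨ interchange (sumTo m f) (sumTo m g) (f (suc m)) (g (suc m)) ⟩
  sumTo (suc m) f + sumTo (suc m) g ∎

sumTo-*ˡ : ∀ m a (f : ℕ → ℤ) → sumTo m (λ k → a * f k) ≡ a * sumTo m f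
sumTo-*ˡ zero    a f = refl
sumTo-*ˡ (suc m) a f = trans (cong (_+ a * f (suc m)) (sumTo-*ˡ m a f))
                             (sym (*-distribˡ-+ a (sumTo m f) (f (suc m))))

sumTo-telescope : ∀ m (f g : ℕ → ℤ) → (∀ {k} → k ≤ m → f k ≡ g (suc k) - g k) →
                  sumTo m f ≡ g (suc m) - g 0
sumTo-telescope zero    f g f≗Δg = f≗Δg z≤n
sumTo-telescope (suc m) f g f≗Δg = begin
  sumTo m f + f (suc m)
    ≡⟨ cong₂ _+_ (sumTo-telescope m f g (λ k≤m → f≗Δg (ℕₚ.m≤n⇒m≤1+n k≤m))) (f≗Δg ℕₚ.≤-refl) ⟩
  g (suc m) - g 0 + (g (suc (suc m)) - g (suc m))
    ≡⟨ cancel (g 0) (g (suc m)) (g (suc (suc m))) ⟩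
  g (suc (suc m)) - g 0 ∎
  where
  cancel : ∀ x y z → y - x + (z - y) ≡ z - x
  cancel = solve-∀

sumTo-vanishing-tail : ∀ d m (f : ℕ → ℤ) → (∀ {k} → m < k → f k ≡ 0ℤ) →
                       sumTo (d ℕ.+ m) f ≡ sumTo m f
sumTo-vanishing-tail zero    m f f>m≡0 = refl
sumTo-vanishing-tail (suc d) m f f>m≡0 = begin
  sumTo (d ℕ.+ m) f + f (suc (d ℕ.+ m))
    ≡⟨ cong (λ x → sumTo (d ℕ.+ m) f + x) (f>m≡0 (s≤s (ℕₚ.m≤n+m m d))) ⟩
  sumTo (d ℕ.+ m) f + 0ℤ
    ≡⟨ +-identityʳ _ ⟩
  sumTo (d ℕ.+ m) f
    ≡⟨ sumTo-vanishing-tail d m f f>m≡0 ⟩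
  sumTo m f ∎

-- shift g n k is g (n - k), with g extended by zero to negative arguments
shift : (ℕ → ℤ) → ℕ → ℕ → ℤ
shift g n       zero    = g n
shift g zero    (suc k) = 0ℤ
shift g (suc n) (suc k) = shift g n k

shift-+ : ∀ g j k → shift g (j ℕ.+ k) k ≡ g j
shift-+ g j zero    = cong g (ℕₚ.+-identityʳ j)
shift-+ g j (suc k) = trans (cong (λ m → shift g m (suc k)) (ℕₚ.+-suc j k)) (shift-+ g j k)

shift-≤ : ∀ g {n k} → k ≤ n → shift g n k ≡ g (n ∸ k)
shift-≤ g {n} {k} k≤n = begin
  shift g n k                   ≡⟨ cong (λ m → shift g m k) (sym (ℕₚ.m∸n+n≡m k≤n)) ⟩
  shift g (n ∸ k ℕ.+ k) k       ≡⟨ shift-+ g (n ∸ k) k ⟩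
  g (n ∸ k)                     ∎

shift-< : ∀ g {n k} → n < k → shift g n k ≡ 0ℤ
shift-< g {zero}  {suc k} _         = refl
shift-< g {suc n} {suc k} (s≤s n<k) = shift-< g n<k

diagonalSum : (ℕ → ℕ → ℤ) → ℕ → ℤ
diagonalSum f n = sumTo n (λ k → f k (n ∸ k))

SolvesRecurrence : (a b c : ℕ → ℤ) → (ℕ → ℤ) → Set
SolvesRecurrence a b c u = ∀ n → a n * u n + b n * u (suc n) + c n * u (suc (suc n)) ≡ 0ℤ

module _ (f G : ℕ → ℕ → ℤ) (a b c : ℕ → ℤ) where

  private
    F : ℕ → ℕ → ℤ
    F n k = shift (f k) n k

    combine : ℕ → ℤ → ℤ → ℤ → ℤ
    combine n x y z = a n * x + b n * y + c n * z

    combine-cong : ∀ n {x x′ y y′ z z′} → x ≡ x′ → y ≡ y′ → z ≡ z′ →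
                   combine n x y z ≡ combine n x′ y′ z′
    combine-cong n refl refl refl = refl

    φ : ℕ → ℕ → ℤ
    φ n k = combine n (F n k) (F (suc n) k) (F (suc (suc n)) k)

    sumTo-F : ∀ d n → sumTo (d ℕ.+ n) (F n) ≡ diagonalSum f n
    sumTo-F d n = begin
      sumTo (d ℕ.+ n) (F n) ≡⟨ sumTo-vanishing-tail d n (F n) (λ {k} → shift-< (f k)) ⟩
      sumTo n (F n)         ≡⟨ sumTo-cong n (λ {k} → shift-≤ (f k)) ⟩
      diagonalSum f n       ∎

    sumTo-combine : ∀ m n (x y z : ℕ → ℤ) →
      sumTo m (λ k → combine n (x k) (y k) (z k)) ≡ combine n (sumTo m x) (sumTo m y) (sumTo m z)
    sumTo-combine m n x y z = begin
      sumTo m (λ k → a n * x k + b n * y k + c n * z k)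
        ≡⟨ sumTo-+ m (λ k → a n * x k + b n * y k) (λ k → c n * z k) ⟩
      sumTo m (λ k → a n * x k + b n * y k) + sumTo m (λ k → c n * z k)
        ≡⟨ cong (_+ sumTo m (λ k → c n * z k)) (sumTo-+ m (λ k → a n * x k) (λ k → b n * y k)) ⟩
      sumTo m (λ k → a n * x k) + sumTo m (λ k → b n * y k) + sumTo m (λ k → c n * z k)
        ≡⟨ cong₂ _+_ (cong₂ _+_ (sumTo-*ˡ m (a n) x) (sumTo-*ˡ m (b n) y)) (sumTo-*ˡ m (c n) z) ⟩
      combine n (sumTo m x) (sumTo m y) (sumTo m z) ∎

    sumTo-φ : ∀ n → sumTo (suc (suc n)) (φ n)
                  ≡ combine n (diagonalSum f n) (diagonalSum f (suc n)) (diagonalSum f (suc (suc n)))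
    sumTo-φ n = trans (sumTo-combine (suc (suc n)) n (F n) (F (suc n)) (F (suc (suc n))))
                      (combine-cong n (sumTo-F 2 n) (sumTo-F 1 (suc n)) (sumTo-F 0 (suc (suc n))))

  -- Creative telescoping with certificate G: besides G n 0 = 0, the hypotheses are the certificate
  -- identity for k ≤ n (as n = j + k), for k = n + 1 and for k = n + 2.
  diagonalSum-recurrence :
    (∀ n → G n 0 ≡ 0ℤ) →
    (∀ j k → a (j ℕ.+ k) * f k j + b (j ℕ.+ k) * f k (suc j) + c (j ℕ.+ k) * f k (suc (suc j))
             ≡ G (j ℕ.+ k) (suc k) - G (j ℕ.+ k) k) →
    (∀ n → b n * f (suc n) 0 + c n * f (suc n) 1 ≡ G n (suc (suc n)) - G n (suc n)) →
    (∀ n → c n * f (suc (suc n)) 0 ≡ - G n (suc (suc n))) →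
    SolvesRecurrence a b c (diagonalSum f)
  diagonalSum-recurrence G-at-0 interior edge corner n = begin
    combine n (diagonalSum f n) (diagonalSum f (suc n)) (diagonalSum f (suc (suc n)))
      ≡⟨ sumTo-φ n ⟨
    sumTo (suc n) (φ n) + φ n (suc (suc n))
      ≡⟨ cong₂ _+_ (sumTo-telescope (suc n) (φ n) (G n) φ≡ΔG) φ-corner ⟩
    G n (suc (suc n)) - G n 0 + - G n (suc (suc n))
      ≡⟨ cong (λ x → G n (suc (suc n)) - x + - G n (suc (suc n))) (G-at-0 n) ⟩
    G n (suc (suc n)) - 0ℤ + - G n (suc (suc n))
      ≡⟨ x-0-x≡0 (G n (suc (suc n))) ⟩
    0ℤ ∎
    where
    x-0-x≡0 : ∀ x → x - 0ℤ + - x ≡ 0ℤ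
    x-0-x≡0 = solve-∀
    drop-zeros : ∀ p q r y z → p * 0ℤ + q * y + r * z ≡ q * y + r * z
    drop-zeros = solve-∀
    drop-zero : ∀ p x → p * 0ℤ + x ≡ x
    drop-zero = solve-∀

    φ-interior : ∀ j k → φ (j ℕ.+ k) k ≡ G (j ℕ.+ k) (suc k) - G (j ℕ.+ k) k
    φ-interior j k = trans (combine-cong (j ℕ.+ k) (shift-+ (f k) j k) (shift-+ (f k) (suc j) k)
                                                   (shift-+ (f k) (suc (suc j)) k))
                           (interior j k)

    φ-edge : φ n (suc n) ≡ G n (suc (suc n)) - G n (suc n)
    φ-edge = begin
      φ n (suc n)
        ≡⟨ combine-cong n (shift-< (f (suc n)) (ℕₚ.n<1+n n))
                          (shift-+ (f (suc n)) 0 (suc n)) (shift-+ (f (suc n)) 1 (suc n)) ⟩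
      a n * 0ℤ + b n * f (suc n) 0 + c n * f (suc n) 1
        ≡⟨ drop-zeros (a n) (b n) (c n) (f (suc n) 0) (f (suc n) 1) ⟩
      b n * f (suc n) 0 + c n * f (suc n) 1
        ≡⟨ edge n ⟩
      G n (suc (suc n)) - G n (suc n) ∎

    φ-corner : φ n (suc (suc n)) ≡ - G n (suc (suc n))
    φ-corner = begin
      φ n (suc (suc n))
        ≡⟨ combine-cong n (shift-< (f (suc (suc n))) (ℕₚ.m≤n⇒m≤1+n (ℕₚ.n<1+n n)))
                          (shift-< (f (suc (suc n))) (ℕₚ.n<1+n (suc n)))
                          (shift-+ (f (suc (suc n))) 0 (suc (suc n))) ⟩
      a n * 0ℤ + b n * 0ℤ + c n * f (suc (suc n)) 0
        ≡⟨ drop-zeros (a n) (b n) (c n) 0ℤ (f (suc (suc n)) 0) ⟩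
      b n * 0ℤ + c n * f (suc (suc n)) 0
        ≡⟨ drop-zero (b n) (c n * f (suc (suc n)) 0) ⟩
      c n * f (suc (suc n)) 0
        ≡⟨ corner n ⟩
      - G n (suc (suc n)) ∎

    φ≡ΔG : ∀ {k} → k ≤ suc n → φ n k ≡ G n (suc k) - G n k
    φ≡ΔG {k} k≤1+n with ℕₚ.m≤n⇒m<n∨m≡n k≤1+n
    ... | inj₂ refl        = φ-edge
    ... | inj₁ (s≤s k≤n) = subst (λ m → φ m k ≡ G m (suc k) - G m k) (ℕₚ.m∸n+n≡m k≤n)
                                 (φ-interior (n ∸ k) k)

x≡y⇒q*[x-y]≡0 : ∀ q {x y : ℤ} → x ≡ y → q * (x - y) ≡ 0ℤ
x≡y⇒q*[x-y]≡0 q {x} refl = trans (cong (q *_) (+-inverseʳ x)) (*-zeroʳ q)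

m*[x-y]≡0⇒x≡y : ∀ m .{{_ : NonZero m}} {x y} → m * (x - y) ≡ 0ℤ → x ≡ y
m*[x-y]≡0⇒x≡y m {x} {y} m*[x-y]≡0 =
  i-j≡0⇒i≡j x y (*-cancelˡ-≡ m (x - y) 0ℤ (trans m*[x-y]≡0 (sym (*-zeroʳ m))))

SolvesRecurrence-unique : ∀ {a b c u v : ℕ → ℤ} → (∀ n → c n ≢ 0ℤ) →
  SolvesRecurrence a b c u → SolvesRecurrence a b c v → u 0 ≡ v 0 → u 1 ≡ v 1 → ∀ n → u n ≡ v n
SolvesRecurrence-unique {a} {b} {c} {u} {v} c≢0 rec-u rec-v u₀≡v₀ u₁≡v₁ n = proj₁ (agree n)
  where
  agree : ∀ n → u n ≡ v n × u (suc n) ≡ v (suc n)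
  agree zero    = u₀≡v₀ , u₁≡v₁
  agree (suc n) with agree n
  ... | uₙ≡vₙ , uₙ₊₁≡vₙ₊₁ = uₙ₊₁≡vₙ₊₁ , m*[x-y]≡0⇒x≡y (c n) {{≢-nonZero (c≢0 n)}} (begin
    c n * (u (suc (suc n)) - v (suc (suc n)))
      ≡⟨ difference (a n) (b n) (c n) (u n) (u (suc n)) (u (suc (suc n))) (v (suc (suc n))) ⟩
    a n * u n + b n * u (suc n) + c n * u (suc (suc n)) - (a n * u n + b n * u (suc n) + c n * v (suc (suc n)))
      ≡⟨ cong₂ (λ x y → a n * u n + b n * u (suc n) + c n * u (suc (suc n)) - (a n * x + b n * y + c n * v (suc (suc n))))
               uₙ≡vₙ uₙ₊₁≡vₙ₊₁ ⟩
    a n * u n + b n * u (suc n) + c n * u (suc (suc n)) - (a n * v n + b n * v (suc n) + c n * v (suc (suc n)))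
      ≡⟨ cong₂ _-_ (rec-u n) (rec-v n) ⟩
    0ℤ ∎)
    where
    difference : ∀ a b c x y z z′ → c * (z - z′) ≡ a * x + b * y + c * z - (a * x + b * y + c * z′)
    difference = solve-∀

SolvesRecurrence-*-hypergeometric : ∀ {p q u a b c v : ℕ → ℤ} → (∀ n → p n * u (suc n) ≡ q n * u n) →
  SolvesRecurrence a b c v →
  SolvesRecurrence (λ n → q n * q (suc n) * a n) (λ n → p n * q (suc n) * b n)
                   (λ n → p n * p (suc n) * c n) (λ n → u n * v n)
SolvesRecurrence-*-hypergeometric {p} {q} {u} {a} {b} {c} {v} ratio rec-v n = begin
  q n * q (suc n) * a n * (u n * v n) + p n * q (suc n) * b n * (u (suc n) * v (suc n))
    + p n * p (suc n) * c n * (u (suc (suc n)) * v (suc (suc n)))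
    ≡⟨ decomposition (p n) (p (suc n)) (q n) (q (suc n)) (a n) (b n) (c n)
                     (u n) (u (suc n)) (u (suc (suc n))) (v n) (v (suc n)) (v (suc (suc n))) ⟩
  q n * q (suc n) * u n * (a n * v n + b n * v (suc n) + c n * v (suc (suc n)))
    + p n * c n * v (suc (suc n)) * (p (suc n) * u (suc (suc n)) - q (suc n) * u (suc n))
    + q (suc n) * (b n * v (suc n) + c n * v (suc (suc n))) * (p n * u (suc n) - q n * u n)
    ≡⟨ cong₂ _+_ (cong₂ _+_ (trans (cong (q n * q (suc n) * u n *_) (rec-v n))
                                   (*-zeroʳ (q n * q (suc n) * u n)))
                            (x≡y⇒q*[x-y]≡0 (p n * c n * v (suc (suc n))) (ratio (suc n))))
                 (x≡y⇒q*[x-y]≡0 (q (suc n) * (b n * v (suc n) + c n * v (suc (suc n)))) (ratio n)) ⟩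
  0ℤ + 0ℤ + 0ℤ ∎
  where
  decomposition : ∀ p₀ p₁ q₀ q₁ a b c u₀ u₁ u₂ v₀ v₁ v₂ →
    q₀ * q₁ * a * (u₀ * v₀) + p₀ * q₁ * b * (u₁ * v₁) + p₀ * p₁ * c * (u₂ * v₂)
    ≡ q₀ * q₁ * u₀ * (a * v₀ + b * v₁ + c * v₂) + p₀ * c * v₂ * (p₁ * u₂ - q₁ * u₁)
      + q₁ * (b * v₁ + c * v₂) * (p₀ * u₁ - q₀ * u₀)
  decomposition = solve-∀

binomial : ℕ → ℕ → ℤ
binomial n k = + (n C k)

central : ℕ → ℤ
central n = binomial (2 ℕ.* n) n

binomial-pascal : ∀ n k → binomial (suc n) (suc k) ≡ binomial n k + binomial n (suc k)
binomial-pascal n k = trans (cong +_ (sym (nCk+nC[k+1]≡[n+1]C[k+1] n k))) (pos-+ (n C k) (n C suc k))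

binomial-absorption : ∀ n k → + suc k * binomial (suc n) (suc k) ≡ + suc n * binomial n k
binomial-absorption zero    zero    = refl
binomial-absorption zero    (suc k) = *-zeroʳ (+ suc (suc k))
binomial-absorption (suc n) zero    = trans (cong (+ 1 *_) (cong +_ (nC1≡n (suc (suc n))))) (*-comm (+ 1) (+ suc (suc n)))
binomial-absorption (suc n) (suc k) = begin
  + suc (suc k) * binomial (suc (suc n)) (suc (suc k))
    ≡⟨ cong (+ suc (suc k) *_) (binomial-pascal (suc n) (suc k)) ⟩
  + suc (suc k) * (binomial (suc n) (suc k) + binomial (suc n) (suc (suc k)))
    ≡⟨ split (+ k) (binomial (suc n) (suc k)) (binomial (suc n) (suc (suc k))) ⟩
  + suc k * binomial (suc n) (suc k) + binomial (suc n) (suc k) + + suc (suc k) * binomial (suc n) (suc (suc k))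
    ≡⟨ cong₂ (λ x y → x + binomial (suc n) (suc k) + y) (binomial-absorption n k) (binomial-absorption n (suc k)) ⟩
  + suc n * binomial n k + binomial (suc n) (suc k) + + suc n * binomial n (suc k)
    ≡⟨ regroup (+ n) (binomial n k) (binomial n (suc k)) (binomial (suc n) (suc k)) ⟩
  + suc n * (binomial n k + binomial n (suc k)) + binomial (suc n) (suc k)
    ≡⟨ cong (λ x → + suc n * x + binomial (suc n) (suc k)) (binomial-pascal n k) ⟨
  + suc n * binomial (suc n) (suc k) + binomial (suc n) (suc k)
    ≡⟨ merge (+ n) (binomial (suc n) (suc k)) ⟩
  + suc (suc n) * binomial (suc n) (suc k) ∎
  where
  split : ∀ K x y → (+ 2 + K) * (x + y) ≡ (+ 1 + K) * x + x + (+ 2 + K) * y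
  split = solve-∀
  regroup : ∀ N x y z → (+ 1 + N) * x + z + (+ 1 + N) * y ≡ (+ 1 + N) * (x + y) + z
  regroup = solve-∀
  merge : ∀ N x → (+ 1 + N) * x + x ≡ (+ 2 + N) * x
  merge = solve-∀

binomial-ratio : ∀ n k → + suc k * binomial n (suc k) ≡ (+ n - + k) * binomial n k
binomial-ratio n k = begin
  + suc k * binomial n (suc k)
    ≡⟨ subtract (+ k) (binomial n k) (binomial n (suc k)) ⟩
  + suc k * (binomial n k + binomial n (suc k)) - + suc k * binomial n k
    ≡⟨ cong (λ x → + suc k * x - + suc k * binomial n k) (binomial-pascal n k) ⟨
  + suc k * binomial (suc n) (suc k) - + suc k * binomial n k
    ≡⟨ cong (_- + suc k * binomial n k) (binomial-absorption n k) ⟩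
  + suc n * binomial n k - + suc k * binomial n k
    ≡⟨ factor (+ n) (+ k) (binomial n k) ⟩
  (+ n - + k) * binomial n k ∎
  where
  subtract : ∀ K x y → (+ 1 + K) * y ≡ (+ 1 + K) * (x + y) - (+ 1 + K) * x
  subtract = solve-∀
  factor : ∀ N K x → (+ 1 + N) * x - (+ 1 + K) * x ≡ (N - K) * x
  factor = solve-∀

central-ratio : ∀ n → + suc n * central (suc n) ≡ + 2 * (+ 2 * + n + + 1) * central n
central-ratio n = begin
  + suc n * binomial (2 ℕ.* suc n) (suc n)
    ≡⟨ cong (λ m → + suc n * binomial m (suc n)) (cong suc (ℕₚ.+-suc n (n ℕ.+ 0))) ⟩
  + suc n * binomial (suc (suc (2 ℕ.* n))) (suc n)
    ≡⟨ cong (+ suc n *_) (binomial-pascal (suc (2 ℕ.* n)) n) ⟩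
  + suc n * (binomial (suc (2 ℕ.* n)) n + binomial (suc (2 ℕ.* n)) (suc n))
    ≡⟨ cong (λ x → + suc n * (x + binomial (suc (2 ℕ.* n)) (suc n))) symmetric ⟩
  + suc n * (binomial (suc (2 ℕ.* n)) (suc n) + binomial (suc (2 ℕ.* n)) (suc n))
    ≡⟨ double (+ n) (binomial (suc (2 ℕ.* n)) (suc n)) ⟩
  + 2 * (+ suc n * binomial (suc (2 ℕ.* n)) (suc n))
    ≡⟨ cong (+ 2 *_) (binomial-absorption (2 ℕ.* n) n) ⟩
  + 2 * ((+ 1 + + (2 ℕ.* n)) * central n)
    ≡⟨ cong (λ x → + 2 * ((+ 1 + x) * central n)) (pos-* 2 n) ⟩
  + 2 * ((+ 1 + + 2 * + n) * central n)
    ≡⟨ reassociate (+ n) (central n) ⟩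
  + 2 * (+ 2 * + n + + 1) * central n ∎
  where
  double : ∀ N x → (+ 1 + N) * (x + x) ≡ + 2 * ((+ 1 + N) * x)
  double = solve-∀
  reassociate : ∀ N x → + 2 * ((+ 1 + + 2 * N) * x) ≡ + 2 * (+ 2 * N + + 1) * x
  reassociate = solve-∀
  symmetric : binomial (suc (2 ℕ.* n)) n ≡ binomial (suc (2 ℕ.* n)) (suc n)
  symmetric = cong +_ (trans (nCk≡nC[n∸k] (ℕₚ.m≤n⇒m≤1+n (ℕₚ.m≤m+n n (n ℕ.+ 0))))
                             (cong (suc (2 ℕ.* n) C_) (trans (cong (λ m → suc (n ℕ.+ m) ∸ n) (ℕₚ.+-identityʳ n))
                                                             (ℕₚ.m+n∸n≡m (suc n) n))))

central²-ratio : ∀ k → + suc k * + suc k * central (suc k) ^ 2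
                       ≡ + 4 * (+ 2 * + k + + 1) * (+ 2 * + k + + 1) * central k ^ 2
central²-ratio k = begin
  + suc k * + suc k * central (suc k) ^ 2
    ≡⟨ square (+ suc k) (central (suc k)) ⟩
  (+ suc k * central (suc k)) * (+ suc k * central (suc k))
    ≡⟨ cong₂ _*_ (central-ratio k) (central-ratio k) ⟩
  (+ 2 * (+ 2 * + k + + 1) * central k) * (+ 2 * (+ 2 * + k + + 1) * central k)
    ≡⟨ expand (+ k) (central k) ⟩
  + 4 * (+ 2 * + k + + 1) * (+ 2 * + k + + 1) * central k ^ 2 ∎
  where
  square : ∀ a c → a * a * (c * (c * + 1)) ≡ (a * c) * (a * c)
  square = solve-∀
  expand : ∀ K c → (+ 2 * (+ 2 * K + + 1) * c) * (+ 2 * (+ 2 * K + + 1) * c)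
                   ≡ + 4 * (+ 2 * K + + 1) * (+ 2 * K + + 1) * (c * (c * + 1))
  expand = solve-∀

central-ratio₂ : ∀ m → + suc m * + suc (suc m) * central (suc (suc m))
                      ≡ + 4 * (+ 2 * + m + + 1) * (+ 2 * + m + + 3) * central m
central-ratio₂ m = begin
  + suc m * + suc (suc m) * central (suc (suc m))
    ≡⟨ *-assoc (+ suc m) (+ suc (suc m)) (central (suc (suc m))) ⟩
  + suc m * (+ suc (suc m) * central (suc (suc m)))
    ≡⟨ cong (+ suc m *_) (central-ratio (suc m)) ⟩
  + suc m * (+ 2 * (+ 2 * + suc m + + 1) * central (suc m))
    ≡⟨ x∙yz≈y∙xz (+ suc m) (+ 2 * (+ 2 * + suc m + + 1)) (central (suc m)) ⟩
  + 2 * (+ 2 * + suc m + + 1) * (+ suc m * central (suc m))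
    ≡⟨ cong (+ 2 * (+ 2 * + suc m + + 1) *_) (central-ratio m) ⟩
  + 2 * (+ 2 * + suc m + + 1) * (+ 2 * (+ 2 * + m + + 1) * central m)
    ≡⟨ collect (+ m) (central m) ⟩
  + 4 * (+ 2 * + m + + 1) * (+ 2 * + m + + 3) * central m ∎
  where
  collect : ∀ M c → + 2 * (+ 2 * (+ 1 + M) + + 1) * (+ 2 * (+ 2 * M + + 1) * c)
                    ≡ + 4 * (+ 2 * M + + 1) * (+ 2 * M + + 3) * c
  collect = solve-∀

binomial-4k-ratio : ∀ k → (+ 1 + + 2 * + k) * (+ 2 + + 2 * + k) * binomial (4 ℕ.* suc k) (2 ℕ.* suc k)
                        ≡ + 4 * (+ 2 * (+ 2 * + k) + + 1) * (+ 2 * (+ 2 * + k) + + 3) * binomial (4 ℕ.* k) (2 ℕ.* k)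
binomial-4k-ratio k = begin
  (+ 1 + + 2 * + k) * (+ 2 + + 2 * + k) * binomial (4 ℕ.* suc k) (2 ℕ.* suc k)
    ≡⟨ cong₂ (λ K₂ a → (+ 1 + K₂) * (+ 2 + K₂) * a) (sym (pos-* 2 k))
             (cong₂ binomial (trans (ℕₚ.*-assoc 2 2 (suc k)) (cong (2 ℕ.*_) 2[1+k]≡2+2k)) 2[1+k]≡2+2k) ⟩
  + suc (2 ℕ.* k) * + suc (suc (2 ℕ.* k)) * central (suc (suc (2 ℕ.* k)))
    ≡⟨ central-ratio₂ (2 ℕ.* k) ⟩
  + 4 * (+ 2 * + (2 ℕ.* k) + + 1) * (+ 2 * + (2 ℕ.* k) + + 3) * central (2 ℕ.* k)
    ≡⟨ cong₂ (λ K₂ a → + 4 * (+ 2 * K₂ + + 1) * (+ 2 * K₂ + + 3) * a) (pos-* 2 k)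
             (cong (λ m → binomial m (2 ℕ.* k)) (sym (ℕₚ.*-assoc 2 2 k))) ⟩
  + 4 * (+ 2 * (+ 2 * + k) + + 1) * (+ 2 * (+ 2 * + k) + + 3) * binomial (4 ℕ.* k) (2 ℕ.* k) ∎
  where
  2[1+k]≡2+2k : 2 ℕ.* suc k ≡ suc (suc (2 ℕ.* k))
  2[1+k]≡2+2k = cong suc (ℕₚ.+-suc k (k ℕ.+ 0))

catalan : ℕ → ℤ
catalan j = central j - binomial (2 ℕ.* j) (suc j)

catalan-central : ∀ j → + suc j * catalan j ≡ central j
catalan-central j = begin
  + suc j * (central j - binomial (2 ℕ.* j) (suc j))
    ≡⟨ distribute (+ j) (central j) (binomial (2 ℕ.* j) (suc j)) ⟩
  + suc j * central j - + suc j * binomial (2 ℕ.* j) (suc j)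
    ≡⟨ cong (λ x → + suc j * central j - x) (binomial-ratio (2 ℕ.* j) j) ⟩
  + suc j * central j - (+ (2 ℕ.* j) - + j) * central j
    ≡⟨ cong (λ x → + suc j * central j - (x - + j) * central j) (pos-* 2 j) ⟩
  + suc j * central j - (+ 2 * + j - + j) * central j
    ≡⟨ collapse (+ j) (central j) ⟩
  central j ∎
  where
  distribute : ∀ J x y → (+ 1 + J) * (x - y) ≡ (+ 1 + J) * x - (+ 1 + J) * y
  distribute = solve-∀
  collapse : ∀ J x → (+ 1 + J) * x - (+ 2 * J - J) * x ≡ x
  collapse = solve-∀

leftSummand : ℕ → ℕ → ℤ
leftSummand k j = central k ^ 2 * central j * (+ 4) ^ j

σ₀ σ₁ σ₂ : ℕ → ℤ
σ₀ n = + 256 * ((+ 1 + + n) * (+ 1 + + n))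
σ₁ n = - + 4 * (+ 8 * + n * + n + + 24 * + n + + 19)
σ₂ n = (+ 2 + + n) * (+ 2 + + n)

-- ω j = 4 ^ j * binomial (2 j) j / (2 j - 1), written without division
ω : ℕ → ℤ
ω zero    = - + 1
ω (suc j) = + 8 * (+ 4) ^ j * catalan j

ω-ratio : ∀ j → + suc j * ω (suc j) ≡ + 8 * (+ 4) ^ j * central j
ω-ratio j = trans (x∙yz≈y∙xz (+ suc j) (+ 8 * (+ 4) ^ j) (catalan j))
                  (cong (+ 8 * (+ 4) ^ j *_) (catalan-central j))

leftCertificate : ℕ → ℕ → ℤ
leftCertificate n k = + k * + k * central k ^ 2 * shift ω (suc (suc n)) k

leftSummand-ratio : ∀ k j → + suc j * leftSummand k (suc j) ≡ + 8 * (+ 2 * + j + + 1) * leftSummand k j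
leftSummand-ratio k j = begin
  + suc j * (central k ^ 2 * central (suc j) * (+ 4 * (+ 4) ^ j))
    ≡⟨ expose (+ suc j) (central k ^ 2) (central (suc j)) ((+ 4) ^ j) ⟩
  + 4 * (central k ^ 2 * (+ suc j * central (suc j)) * (+ 4) ^ j)
    ≡⟨ cong (λ x → + 4 * (central k ^ 2 * x * (+ 4) ^ j)) (central-ratio j) ⟩
  + 4 * (central k ^ 2 * (+ 2 * (+ 2 * + j + + 1) * central j) * (+ 4) ^ j)
    ≡⟨ collect (+ j) (central k ^ 2) (central j) ((+ 4) ^ j) ⟩
  + 8 * (+ 2 * + j + + 1) * leftSummand k j ∎
  where
  expose : ∀ J U c P → J * (U * c * (+ 4 * P)) ≡ + 4 * (U * (J * c) * P)
  expose = solve-∀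
  collect : ∀ J U c P → + 4 * (U * (+ 2 * (+ 2 * J + + 1) * c) * P) ≡ + 8 * (+ 2 * J + + 1) * (U * c * P)
  collect = solve-∀

leftCertificate-suc-ratio : ∀ j k → + suc j * leftCertificate (j ℕ.+ k) (suc k)
                                 ≡ + 32 * (+ 2 * + k + + 1) * (+ 2 * + k + + 1) * leftSummand k j
leftCertificate-suc-ratio j k = begin
  + suc j * (+ suc k * + suc k * central (suc k) ^ 2 * shift ω (suc j ℕ.+ k) k)
    ≡⟨ cong (λ x → + suc j * (+ suc k * + suc k * central (suc k) ^ 2 * x)) (shift-+ ω (suc j) k) ⟩
  + suc j * (+ suc k * + suc k * central (suc k) ^ 2 * ω (suc j))
    ≡⟨ x∙yz≈y∙xz (+ suc j) (+ suc k * + suc k * central (suc k) ^ 2) (ω (suc j)) ⟩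
  + suc k * + suc k * central (suc k) ^ 2 * (+ suc j * ω (suc j))
    ≡⟨ cong₂ _*_ (central²-ratio k) (ω-ratio j) ⟩
  + 4 * (+ 2 * + k + + 1) * (+ 2 * + k + + 1) * central k ^ 2 * (+ 8 * (+ 4) ^ j * central j)
    ≡⟨ collect (+ k) (central k ^ 2) (central j) ((+ 4) ^ j) ⟩
  + 32 * (+ 2 * + k + + 1) * (+ 2 * + k + + 1) * leftSummand k j ∎
  where
  collect : ∀ K U c P → + 4 * (+ 2 * K + + 1) * (+ 2 * K + + 1) * U * (+ 8 * P * c)
                        ≡ + 32 * (+ 2 * K + + 1) * (+ 2 * K + + 1) * (U * c * P)
  collect = solve-∀

leftCertificate-ratio : ∀ j k → + suc (suc j) * leftCertificate (j ℕ.+ k) k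
                                 ≡ + 8 * (+ k * + k) * leftSummand k (suc j)
leftCertificate-ratio j k = begin
  + suc (suc j) * (+ k * + k * central k ^ 2 * shift ω (suc (suc j) ℕ.+ k) k)
    ≡⟨ cong (λ x → + suc (suc j) * (+ k * + k * central k ^ 2 * x)) (shift-+ ω (suc (suc j)) k) ⟩
  + suc (suc j) * (+ k * + k * central k ^ 2 * ω (suc (suc j)))
    ≡⟨ x∙yz≈y∙xz (+ suc (suc j)) (+ k * + k * central k ^ 2) (ω (suc (suc j))) ⟩
  + k * + k * central k ^ 2 * (+ suc (suc j) * ω (suc (suc j)))
    ≡⟨ cong (+ k * + k * central k ^ 2 *_) (ω-ratio (suc j)) ⟩
  + k * + k * central k ^ 2 * (+ 8 * (+ 4) ^ suc j * central (suc j))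
    ≡⟨ collect (+ k) (central k ^ 2) (central (suc j)) ((+ 4) ^ suc j) ⟩
  + 8 * (+ k * + k) * leftSummand k (suc j) ∎
  where
  collect : ∀ K U c P → K * K * U * (+ 8 * P * c) ≡ + 8 * (K * K) * (U * c * P)
  collect = solve-∀

left-telescoping-identity : ∀ j k {X₀ X₁ X₂ G₀ G₁ : ℤ} →
  + suc j * X₁ ≡ + 8 * (+ 2 * + j + + 1) * X₀ →
  + suc (suc j) * X₂ ≡ + 8 * (+ 2 * + suc j + + 1) * X₁ →
  + suc j * G₁ ≡ + 32 * (+ 2 * + k + + 1) * (+ 2 * + k + + 1) * X₀ →
  + suc (suc j) * G₀ ≡ + 8 * (+ k * + k) * X₁ →
  σ₀ (j ℕ.+ k) * X₀ + σ₁ (j ℕ.+ k) * X₁ + σ₂ (j ℕ.+ k) * X₂ ≡ G₁ - G₀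
left-telescoping-identity j k {X₀} {X₁} {X₂} {G₀} {G₁} X-ratio₀ X-ratio₁ G₁-ratio G₀-ratio =
  m*[x-y]≡0⇒x≡y (+ suc j * + suc (suc j)) (begin
    + suc j * + suc (suc j) * (σ₀ (j ℕ.+ k) * X₀ + σ₁ (j ℕ.+ k) * X₁ + σ₂ (j ℕ.+ k) * X₂ - (G₁ - G₀))
      ≡⟨ decomposition (+ j) (+ k) X₀ X₁ X₂ G₀ G₁ ⟩
    q₁ * (+ suc j * X₁ - + 8 * (+ 2 * + j + + 1) * X₀)
      + q₂ * (+ suc (suc j) * X₂ - + 8 * (+ 2 * + suc j + + 1) * X₁)
      - + suc (suc j) * (+ suc j * G₁ - + 32 * (+ 2 * + k + + 1) * (+ 2 * + k + + 1) * X₀)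
      + + suc j * (+ suc (suc j) * G₀ - + 8 * (+ k * + k) * X₁)
      ≡⟨ cong₂ _+_ (cong₂ _-_ (cong₂ _+_ (x≡y⇒q*[x-y]≡0 q₁ X-ratio₀) (x≡y⇒q*[x-y]≡0 q₂ X-ratio₁))
                              (x≡y⇒q*[x-y]≡0 (+ suc (suc j)) G₁-ratio))
                   (x≡y⇒q*[x-y]≡0 (+ suc j) G₀-ratio) ⟩
    0ℤ + 0ℤ - 0ℤ + 0ℤ ∎)
  where
  n = j ℕ.+ k
  q₁ q₂ : ℤ
  q₁ = σ₁ n * + suc (suc j) + + 8 * (σ₂ n * (+ 2 * + j + + 3) + + k * + k)
  q₂ = σ₂ n * + suc j
  -- substituting the recurrences one at a time leaves a multiple of X₀ whose coefficient vanishes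
  decomposition : ∀ J K X₀ X₁ X₂ G₀ G₁ →
    (+ 1 + J) * (+ 2 + J) * (+ 256 * ((+ 1 + (J + K)) * (+ 1 + (J + K))) * X₀
      + - + 4 * (+ 8 * (J + K) * (J + K) + + 24 * (J + K) + + 19) * X₁
      + (+ 2 + (J + K)) * (+ 2 + (J + K)) * X₂ - (G₁ - G₀))
    ≡ (- + 4 * (+ 8 * (J + K) * (J + K) + + 24 * (J + K) + + 19) * (+ 2 + J)
        + + 8 * ((+ 2 + (J + K)) * (+ 2 + (J + K)) * (+ 2 * J + + 3) + K * K))
        * ((+ 1 + J) * X₁ - + 8 * (+ 2 * J + + 1) * X₀)
      + (+ 2 + (J + K)) * (+ 2 + (J + K)) * (+ 1 + J) * ((+ 2 + J) * X₂ - + 8 * (+ 2 * (+ 1 + J) + + 1) * X₁)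
      - (+ 2 + J) * ((+ 1 + J) * G₁ - + 32 * (+ 2 * K + + 1) * (+ 2 * K + + 1) * X₀)
      + (+ 1 + J) * ((+ 2 + J) * G₀ - + 8 * (K * K) * X₁)
  decomposition = solve-∀

leftSum : ℕ → ℤ
leftSum = diagonalSum leftSummand

leftSum-recurrence : SolvesRecurrence σ₀ σ₁ σ₂ leftSum
leftSum-recurrence = diagonalSum-recurrence leftSummand leftCertificate σ₀ σ₁ σ₂ (λ _ → refl)
  (λ j k → left-telescoping-identity j k (leftSummand-ratio k j) (leftSummand-ratio k (suc j))
                             (leftCertificate-suc-ratio j k) (leftCertificate-ratio j k))
  edge corner
  where
  edge : ∀ n → σ₁ n * leftSummand (suc n) 0 + σ₂ n * leftSummand (suc n) 1
               ≡ leftCertificate n (suc (suc n)) - leftCertificate n (suc n)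
  edge n = begin
    σ₁ n * leftSummand (suc n) 0 + σ₂ n * leftSummand (suc n) 1
      ≡⟨ evaluate (+ n) (central (suc n) ^ 2) ⟩
    + 4 * (+ 2 * + suc n + + 1) * (+ 2 * + suc n + + 1) * central (suc n) ^ 2 * ω 0
      - + suc n * + suc n * central (suc n) ^ 2 * ω 1
      ≡⟨ cong₂ (λ x y → x * y - + suc n * + suc n * central (suc n) ^ 2 * ω 1)
               (central²-ratio (suc n)) (shift-+ ω 0 (suc (suc n))) ⟨
    + suc (suc n) * + suc (suc n) * central (suc (suc n)) ^ 2 * shift ω (suc (suc n)) (suc (suc n))
      - + suc n * + suc n * central (suc n) ^ 2 * ω 1
      ≡⟨ cong (λ x → leftCertificate n (suc (suc n)) - + suc n * + suc n * central (suc n) ^ 2 * x)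
              (shift-+ ω 1 (suc n)) ⟨
    leftCertificate n (suc (suc n)) - leftCertificate n (suc n) ∎
    where
    evaluate : ∀ N U → - + 4 * (+ 8 * N * N + + 24 * N + + 19) * (U * + 1 * + 1)
                         + (+ 2 + N) * (+ 2 + N) * (U * + 2 * (+ 4 * + 1))
                       ≡ + 4 * (+ 2 * (+ 1 + N) + + 1) * (+ 2 * (+ 1 + N) + + 1) * U * - + 1
                         - (+ 1 + N) * (+ 1 + N) * U * + 8
    evaluate = solve-∀
  corner : ∀ n → σ₂ n * leftSummand (suc (suc n)) 0 ≡ - leftCertificate n (suc (suc n))
  corner n = begin
    σ₂ n * leftSummand (suc (suc n)) 0
      ≡⟨ evaluate (+ n) (central (suc (suc n)) ^ 2) ⟩
    - (+ suc (suc n) * + suc (suc n) * central (suc (suc n)) ^ 2 * ω 0)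
      ≡⟨ cong (λ x → - (+ suc (suc n) * + suc (suc n) * central (suc (suc n)) ^ 2 * x))
              (shift-+ ω 0 (suc (suc n))) ⟨
    - leftCertificate n (suc (suc n)) ∎
    where
    evaluate : ∀ N U → (+ 2 + N) * (+ 2 + N) * (U * + 1 * + 1) ≡ - ((+ 2 + N) * (+ 2 + N) * U * - + 1)
    evaluate = solve-∀

rightWeight : ℕ → ℤ
rightWeight k = binomial (4 ℕ.* k) (2 ℕ.* k) * central k ^ 2

rightWeight-den rightWeight-num : ℕ → ℤ
rightWeight-den k = (+ 1 + + 2 * + k) * (+ 2 + + 2 * + k) * (+ suc k * + suc k)
rightWeight-num k = + 4 * (+ 2 * (+ 2 * + k) + + 1) * (+ 2 * (+ 2 * + k) + + 3)
                      * (+ 4 * (+ 2 * + k + + 1) * (+ 2 * + k + + 1))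

rightWeight-den≢0 : ∀ k → rightWeight-den k ≢ 0ℤ
rightWeight-den≢0 k = subst (_≢ 0ℤ) (cong (λ K₂ → (+ 1 + K₂) * (+ 2 + K₂) * (+ suc k * + suc k)) (pos-* 2 k)) (λ ())

rightWeight-ratio : ∀ k → rightWeight-den k * rightWeight (suc k) ≡ rightWeight-num k * rightWeight k
rightWeight-ratio k = begin
  (+ 1 + + 2 * + k) * (+ 2 + + 2 * + k) * (+ suc k * + suc k) * (a′ * central (suc k) ^ 2)
    ≡⟨ interchange-* ((+ 1 + + 2 * + k) * (+ 2 + + 2 * + k)) (+ suc k * + suc k) a′ (central (suc k) ^ 2) ⟩
  (+ 1 + + 2 * + k) * (+ 2 + + 2 * + k) * a′ * (+ suc k * + suc k * central (suc k) ^ 2)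
    ≡⟨ cong₂ _*_ (binomial-4k-ratio k) (central²-ratio k) ⟩
  + 4 * (+ 2 * (+ 2 * + k) + + 1) * (+ 2 * (+ 2 * + k) + + 3) * a
    * (+ 4 * (+ 2 * + k + + 1) * (+ 2 * + k + + 1) * central k ^ 2)
    ≡⟨ interchange-* (+ 4 * (+ 2 * (+ 2 * + k) + + 1) * (+ 2 * (+ 2 * + k) + + 3))
                     (+ 4 * (+ 2 * + k + + 1) * (+ 2 * + k + + 1)) a (central k ^ 2) ⟨
  + 4 * (+ 2 * (+ 2 * + k) + + 1) * (+ 2 * (+ 2 * + k) + + 3)
    * (+ 4 * (+ 2 * + k + + 1) * (+ 2 * + k + + 1)) * (a * central k ^ 2) ∎
  where
  a′ = binomial (4 ℕ.* suc k) (2 ℕ.* suc k)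
  a  = binomial (4 ℕ.* k) (2 ℕ.* k)
  interchange-* : ∀ p q x y → p * q * (x * y) ≡ p * x * (q * y)
  interchange-* = solve-∀

rightSummand : ℕ → ℕ → ℤ
rightSummand k j = rightWeight k * binomial k j * (- + 64) ^ j

rightSummand-ratio : ∀ k j → + suc j * rightSummand k (suc j) ≡ - + 64 * (+ k - + j) * rightSummand k j
rightSummand-ratio k j = begin
  + suc j * (rightWeight k * binomial k (suc j) * (- + 64 * (- + 64) ^ j))
    ≡⟨ expose (+ suc j) (rightWeight k) (binomial k (suc j)) ((- + 64) ^ j) ⟩
  - + 64 * (rightWeight k * (+ suc j * binomial k (suc j)) * (- + 64) ^ j)
    ≡⟨ cong (λ x → - + 64 * (rightWeight k * x * (- + 64) ^ j)) (binomial-ratio k j) ⟩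
  - + 64 * (rightWeight k * ((+ k - + j) * binomial k j) * (- + 64) ^ j)
    ≡⟨ collect (+ k - + j) (rightWeight k) (binomial k j) ((- + 64) ^ j) ⟩
  - + 64 * (+ k - + j) * rightSummand k j ∎
  where
  expose : ∀ J A b Y → J * (A * b * (- + 64 * Y)) ≡ - + 64 * (A * (J * b) * Y)
  expose = solve-∀
  collect : ∀ D A b Y → - + 64 * (A * (D * b) * Y) ≡ - + 64 * D * (A * b * Y)
  collect = solve-∀

rightSummand-diagonal-ratio : ∀ k j → rightWeight-den k * + suc j * rightSummand (suc k) (suc j)
                                      ≡ rightWeight-num k * + suc k * - + 64 * rightSummand k j
rightSummand-diagonal-ratio k j = begin
  P * + suc j * (rightWeight (suc k) * binomial (suc k) (suc j) * (- + 64 * (- + 64) ^ j))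
    ≡⟨ separate P (+ suc j) (rightWeight (suc k)) (binomial (suc k) (suc j)) ((- + 64) ^ j) ⟩
  P * rightWeight (suc k) * (+ suc j * binomial (suc k) (suc j)) * (- + 64 * (- + 64) ^ j)
    ≡⟨ cong₂ (λ x y → x * y * (- + 64 * (- + 64) ^ j)) (rightWeight-ratio k) (binomial-absorption k j) ⟩
  Q * rightWeight k * (+ suc k * binomial k j) * (- + 64 * (- + 64) ^ j)
    ≡⟨ collect Q (+ suc k) (rightWeight k) (binomial k j) ((- + 64) ^ j) ⟩
  Q * + suc k * - + 64 * rightSummand k j ∎
  where
  P = rightWeight-den k
  Q = rightWeight-num k
  separate : ∀ P J A b Y → P * J * (A * b * (- + 64 * Y)) ≡ P * A * (J * b) * (- + 64 * Y)
  separate = solve-∀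
  collect : ∀ Q K A b Y → Q * A * (K * b) * (- + 64 * Y) ≡ Q * K * - + 64 * (A * b * Y)
  collect = solve-∀

-- σ transported by the factor central n, whose ratio central (n + 1) / central n is 2 (2n + 1) / (n + 1)
τ₀ τ₁ τ₂ : ℕ → ℤ
τ₀ n = + 2 * (+ 2 * + n + + 1) * (+ 2 * (+ 2 * + suc n + + 1)) * σ₀ n
τ₁ n = + suc n * (+ 2 * (+ 2 * + suc n + + 1)) * σ₁ n
τ₂ n = + suc n * + suc (suc n) * σ₂ n

rightCertificate : ℕ → ℕ → ℤ
rightCertificate n k = - (+ k * + k * (+ suc n * + suc (suc n)) * shift (rightSummand k) (suc (suc n)) k)

right-telescoping-identity : ∀ j k {X₀ X₁ X₂ X′ : ℤ} →
  + suc j * X₁ ≡ - + 64 * (+ k - + j) * X₀ →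
  + suc (suc j) * X₂ ≡ - + 64 * (+ k - + suc j) * X₁ →
  rightWeight-den k * + suc j * X′ ≡ rightWeight-num k * + suc k * - + 64 * X₀ →
  let n = j ℕ.+ k ; N = + suc n * + suc (suc n) in
  τ₀ n * X₀ + τ₁ n * X₁ + τ₂ n * X₂ ≡ - (+ suc k * + suc k * N * X′) - - (+ k * + k * N * X₂)
right-telescoping-identity j k {X₀} {X₁} {X₂} {X′} X-ratio₀ X-ratio₁ X′-ratio =
  m*[x-y]≡0⇒x≡y (rightWeight-den k * (+ suc j * + suc (suc j)))
                {{i*j≢0 (rightWeight-den k) (+ suc j * + suc (suc j)) {{≢-nonZero (rightWeight-den≢0 k)}}}} (begin
    rightWeight-den k * (+ suc j * + suc (suc j))
      * (τ₀ n * X₀ + τ₁ n * X₁ + τ₂ n * X₂ - (- (+ suc k * + suc k * N * X′) - - (+ k * + k * N * X₂)))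
      ≡⟨ decomposition (+ j) (+ k) X₀ X₁ X₂ X′ ⟩
    q₁ * (+ suc j * X₁ - - + 64 * (+ k - + j) * X₀)
      + q₂ * (+ suc (suc j) * X₂ - - + 64 * (+ k - + suc j) * X₁)
      + q₃ * (rightWeight-den k * + suc j * X′ - rightWeight-num k * + suc k * - + 64 * X₀)
      ≡⟨ cong₂ _+_ (cong₂ _+_ (x≡y⇒q*[x-y]≡0 q₁ X-ratio₀) (x≡y⇒q*[x-y]≡0 q₂ X-ratio₁))
                   (x≡y⇒q*[x-y]≡0 q₃ X′-ratio) ⟩
    0ℤ + 0ℤ + 0ℤ ∎)
  where
  n = j ℕ.+ k
  N = + suc n * + suc (suc n)
  q₁ q₂ q₃ : ℤ
  q₁ = rightWeight-den k * (τ₁ n * + suc (suc j) + (τ₂ n - N * (+ k * + k)) * - + 64 * (+ k - + suc j))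
  q₂ = (τ₂ n - N * (+ k * + k)) * rightWeight-den k * + suc j
  q₃ = N * (+ suc k * + suc k) * + suc (suc j)
  decomposition : ∀ J K X₀ X₁ X₂ X′ →
    let n = J + K ; N = (+ 1 + n) * (+ 2 + n)
        P = (+ 1 + + 2 * K) * (+ 2 + + 2 * K) * ((+ 1 + K) * (+ 1 + K))
        Q = + 4 * (+ 2 * (+ 2 * K) + + 1) * (+ 2 * (+ 2 * K) + + 3) * (+ 4 * (+ 2 * K + + 1) * (+ 2 * K + + 1))
        τ₀ = + 2 * (+ 2 * n + + 1) * (+ 2 * (+ 2 * (+ 1 + n) + + 1)) * (+ 256 * ((+ 1 + n) * (+ 1 + n)))
        τ₁ = (+ 1 + n) * (+ 2 * (+ 2 * (+ 1 + n) + + 1)) * (- + 4 * (+ 8 * n * n + + 24 * n + + 19))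
        τ₂ = (+ 1 + n) * (+ 2 + n) * ((+ 2 + n) * (+ 2 + n))
    in P * ((+ 1 + J) * (+ 2 + J))
         * (τ₀ * X₀ + τ₁ * X₁ + τ₂ * X₂ - (- ((+ 1 + K) * (+ 1 + K) * N * X′) - - (K * K * N * X₂)))
       ≡ P * (τ₁ * (+ 2 + J) + (τ₂ - N * (K * K)) * - + 64 * (K - (+ 1 + J)))
           * ((+ 1 + J) * X₁ - - + 64 * (K - J) * X₀)
         + (τ₂ - N * (K * K)) * P * (+ 1 + J) * ((+ 2 + J) * X₂ - - + 64 * (K - (+ 1 + J)) * X₁)
         + N * ((+ 1 + K) * (+ 1 + K)) * (+ 2 + J) * (P * (+ 1 + J) * X′ - Q * (+ 1 + K) * - + 64 * X₀)
  decomposition = solve-∀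

rightSum : ℕ → ℤ
rightSum = diagonalSum rightSummand

rightSum-recurrence : SolvesRecurrence τ₀ τ₁ τ₂ rightSum
rightSum-recurrence = diagonalSum-recurrence rightSummand rightCertificate τ₀ τ₁ τ₂ (λ _ → refl)
  interior edge corner
  where
  interior : ∀ j k → τ₀ (j ℕ.+ k) * rightSummand k j + τ₁ (j ℕ.+ k) * rightSummand k (suc j)
                       + τ₂ (j ℕ.+ k) * rightSummand k (suc (suc j))
                     ≡ rightCertificate (j ℕ.+ k) (suc k) - rightCertificate (j ℕ.+ k) k
  interior j k = trans
    (right-telescoping-identity j k (rightSummand-ratio k j) (rightSummand-ratio k (suc j)) (rightSummand-diagonal-ratio k j))
    (cong₂ (λ x y → - (+ suc k * + suc k * N * x) - - (+ k * + k * N * y))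
           (sym (shift-+ (rightSummand (suc k)) (suc j) k)) (sym (shift-+ (rightSummand k) (suc (suc j)) k)))
    where N = + suc (j ℕ.+ k) * + suc (suc (j ℕ.+ k))

  edge : ∀ n → τ₁ n * rightSummand (suc n) 0 + τ₂ n * rightSummand (suc n) 1
               ≡ rightCertificate n (suc (suc n)) - rightCertificate n (suc n)
  edge n = begin
    τ₁ n * rightSummand (suc n) 0 + τ₂ n * rightSummand (suc n) 1
      ≡⟨ cong (λ b → τ₁ n * (A * + 1 * + 1) + τ₂ n * (A * b * (- + 64 * + 1))) (cong +_ (nC1≡n (suc n))) ⟩
    τ₁ n * (A * + 1 * + 1) + τ₂ n * (A * + suc n * (- + 64 * + 1))
      ≡⟨ m*[x-y]≡0⇒x≡y (rightWeight-den (suc n)) {{≢-nonZero (rightWeight-den≢0 (suc n))}} (begin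
           rightWeight-den (suc n) * (τ₁ n * (A * + 1 * + 1) + τ₂ n * (A * + suc n * (- + 64 * + 1))
             - (- (+ suc (suc n) * + suc (suc n) * N * (A″ * + 1 * + 1))
                - - (+ suc n * + suc n * N * (A * + suc n * (- + 64 * + 1)))))
             ≡⟨ decomposition (+ n) A A″ ⟩
           N * (+ suc (suc n) * + suc (suc n)) * (rightWeight-den (suc n) * A″ - rightWeight-num (suc n) * A)
             ≡⟨ x≡y⇒q*[x-y]≡0 (N * (+ suc (suc n) * + suc (suc n))) (rightWeight-ratio (suc n)) ⟩
           0ℤ ∎) ⟩
    - (+ suc (suc n) * + suc (suc n) * N * (A″ * + 1 * + 1))
      - - (+ suc n * + suc n * N * (A * + suc n * (- + 64 * + 1)))
      ≡⟨ cong₂ (λ x y → - (+ suc (suc n) * + suc (suc n) * N * x) - - (+ suc n * + suc n * N * y))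
               (sym (shift-+ (rightSummand (suc (suc n))) 0 (suc (suc n))))
               (trans (cong (λ b → A * b * (- + 64 * + 1)) (cong +_ (sym (nC1≡n (suc n)))))
                      (sym (shift-+ (rightSummand (suc n)) 1 (suc n)))) ⟩
    rightCertificate n (suc (suc n)) - rightCertificate n (suc n) ∎
    where
    A = rightWeight (suc n)
    A″ = rightWeight (suc (suc n))
    N = + suc n * + suc (suc n)
    decomposition : ∀ M A A″ →
      let N = (+ 1 + M) * (+ 2 + M) ; K = + 1 + M
          P = (+ 1 + + 2 * K) * (+ 2 + + 2 * K) * ((+ 1 + K) * (+ 1 + K))
          Q = + 4 * (+ 2 * (+ 2 * K) + + 1) * (+ 2 * (+ 2 * K) + + 3) * (+ 4 * (+ 2 * K + + 1) * (+ 2 * K + + 1))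
          τ₁ = (+ 1 + M) * (+ 2 * (+ 2 * (+ 1 + M) + + 1)) * (- + 4 * (+ 8 * M * M + + 24 * M + + 19))
          τ₂ = (+ 1 + M) * (+ 2 + M) * ((+ 2 + M) * (+ 2 + M))
      in P * (τ₁ * (A * + 1 * + 1) + τ₂ * (A * (+ 1 + M) * (- + 64 * + 1))
               - (- ((+ 2 + M) * (+ 2 + M) * N * (A″ * + 1 * + 1))
                  - - ((+ 1 + M) * (+ 1 + M) * N * (A * (+ 1 + M) * (- + 64 * + 1)))))
         ≡ N * ((+ 2 + M) * (+ 2 + M)) * (P * A″ - Q * A)
    decomposition = solve-∀

  corner : ∀ n → τ₂ n * rightSummand (suc (suc n)) 0 ≡ - rightCertificate n (suc (suc n))
  corner n = begin
    τ₂ n * rightSummand (suc (suc n)) 0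
      ≡⟨ evaluate (+ n) (rightWeight (suc (suc n))) ⟩
    - - (+ suc (suc n) * + suc (suc n) * (+ suc n * + suc (suc n)) * rightSummand (suc (suc n)) 0)
      ≡⟨ cong (λ x → - - (+ suc (suc n) * + suc (suc n) * (+ suc n * + suc (suc n)) * x))
              (shift-+ (rightSummand (suc (suc n))) 0 (suc (suc n))) ⟨
    - rightCertificate n (suc (suc n)) ∎
    where
    evaluate : ∀ M A → (+ 1 + M) * (+ 2 + M) * ((+ 2 + M) * (+ 2 + M)) * (A * + 1 * + 1)
                       ≡ - - ((+ 2 + M) * (+ 2 + M) * ((+ 1 + M) * (+ 2 + M)) * (A * + 1 * + 1))
    evaluate = solve-∀

leftHandSide-recurrence : SolvesRecurrence τ₀ τ₁ τ₂ (λ n → central n * leftSum n)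
leftHandSide-recurrence =
  SolvesRecurrence-*-hypergeometric {λ n → + suc n} {λ n → + 2 * (+ 2 * + n + + 1)} {central} {σ₀} {σ₁} {σ₂}
                                    central-ratio leftSum-recurrence

lemma2p2 : (n : ℕ) →
    (+ ((2 Data.Nat.* n) C n)) * sumTo n (λ k → (+ ((2 Data.Nat.* k) C k)) ^ 2 * (+ ((2 Data.Nat.* (n ∸ k)) C (n ∸ k))) * (+ 4) ^ (n ∸ k))
      ≡ sumTo n (λ k → (+ ((4 Data.Nat.* k) C (2 Data.Nat.* k))) * (+ ((2 Data.Nat.* k) C k)) ^ 2 * (+ (k C (n ∸ k))) * (- (+ 64)) ^ (n ∸ k))
lemma2p2 = SolvesRecurrence-unique {τ₀} {τ₁} {τ₂} (λ _ ()) leftHandSide-recurrence rightSum-recurrence refl refl
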